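{- Let $F=C_1\land\cdots\land C_M$ be a Boolean formula in conjunctive normal form over variables $u_1,\dots,u_N$, each clause $C_i$ being a disjunction of literals of the form $u_k$ or $\bar u_k=\lnot u_k$. Define the instance $\mathcal{D}(F)=(X,V,E_0,E_1,d_{0,V})$ as follows: $X=\{\mathsf{TRUE}\}\cup\{u_j,a_j,\bar a_j,\bar u_j: 1\le j\le N\}\cup\{C_1,\dots,C_M\}$ (a set of $1+4N+M$ distinct symbols); $V=\{(u_j,\bar u_j):1\le j\le N\}\cup\{(\mathsf{TRUE},C_i):1\le i\le M\}$; $E_0=\emptyset$; $E_1$ is the union of $\{\{\mathsf{TRUE},u_j\},\{\mathsf{TRUE},\bar u_j\}: 1\le j\le N\}$, $\{\{u_j,a_j\},\{a_j,\bar a_j\},\{\bar a_j,\bar u_j\}:1\le j\le N\}$, $\{\{a_j,C_i\}: u_j \text{ is a literal of } C_i\}$ and $\{\{\bar a_j,C_i\}: \bar u_j\text{ is a literal of } C_i\}$; and $d_{0,V}(x,y)=3$ for all $(x,y)\in V$. Then there exists a set of edges $E$ with $E_0\subset E\subset E_1$ such that $d_E(x,y)=d_{0,V}(x,y)$ for all $(x,y)\in V$ if and only if $F$ is satisfiable.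
   Context: For a simple undirected graph $(X,E)$, $d_E(x,y)$ denotes the graph distance, i.e. the minimal number of edges of a path connecting $x$ and $y$ ($\infty$ if there is none). -}

module Defs where

open import Data.Nat using (ℕ; zero; suc; _≤_)
open import Data.Fin using (Fin)
open import Data.Bool using (Bool; true; false)
open import Data.Product using (_×_; _,_; proj₁; proj₂; Σ; ∃)
open import Data.Sum using (_⊎_)
open import Data.List using (List)
open import Data.List.Membership.Propositional using (_∈_)
open import Data.List.Relation.Unary.Any using (Any)
open import Relation.Binary.PropositionalEquality using (_≡_)
open import Function.Bundles using (_⇔_)

-- A literal over variables u_0..u_{N-1}: (k , true) is u_k, (k , false) is ¬u_k.
Literal : ℕ → Set
Literal N = Fin N × Bool

Clause : ℕ → Set
Clause N = List (Literal N)

CNF : ℕ → ℕ → Set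
CNF N M = Fin M → Clause N

Assignment : ℕ → Set
Assignment N = Fin N → Bool

LitTrue : ∀ {N} → Assignment N → Literal N → Set
LitTrue σ (k , b) = σ k ≡ b

Satisfies : ∀ {N M} → Assignment N → CNF N M → Set
Satisfies σ F = ∀ i → Any (LitTrue σ) (F i)

Satisfiable : ∀ {N M} → CNF N M → Set
Satisfiable {N} F = Σ (Assignment N) (λ σ → Satisfies σ F)

data X (N M : ℕ) : Set where
  TRUE : X N M
  u a abar ubar : Fin N → X N M
  C : Fin M → X N M

-- the candidate edges E_1, listed in one orientation
data E1dir {N M : ℕ} (F : CNF N M) : X N M → X N M → Set where
  t-u    : ∀ j → E1dir F TRUE (u j)
  t-ubar : ∀ j → E1dir F TRUE (ubar j)
  u-a    : ∀ j → E1dir F (u j) (a j)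
  a-abar : ∀ j → E1dir F (a j) (abar j)
  abar-ubar : ∀ j → E1dir F (abar j) (ubar j)
  a-C    : ∀ j i → (j , true) ∈ F i → E1dir F (a j) (C i)
  abar-C : ∀ j i → (j , false) ∈ F i → E1dir F (abar j) (C i)

E1 : ∀ {N M} → CNF N M → X N M → X N M → Set
E1 F x y = E1dir F x y ⊎ E1dir F y x

data InV {N M : ℕ} : X N M → X N M → Set where
  uv : ∀ j → InV (u j) (ubar j)
  tc : ∀ i → InV TRUE (C i)

d0V : ℕ
d0V = 3

EdgeSet : ℕ → ℕ → Set
EdgeSet N M = X N M → X N M → Bool

data Walk {N M : ℕ} (E : EdgeSet N M) : X N M → X N M → ℕ → Set where
  nil  : ∀ {x} → Walk E x x 0
  cons : ∀ {x y z n} → E x y ≡ true → Walk E y z n → Walk E x z (suc n)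

DistEq : ∀ {N M} → EdgeSet N M → X N M → X N M → ℕ → Set
DistEq E x y n = Walk E x y n × (∀ m → Walk E x y m → n ≤ m)

-- E is an admissible edge set: undirected, E_0 = ∅ ⊆ E ⊆ E_1
Admissible : ∀ {N M} → CNF N M → EdgeSet N M → Set
Admissible F E = (∀ x y → E x y ≡ E y x) × (∀ x y → E x y ≡ true → E1 F x y)

Realizable : ∀ {N M} → CNF N M → Set
Realizable {N} {M} F =
  Σ (EdgeSet N M) (λ E → Admissible F E × (∀ x y → InV x y → DistEq E x y d0V))

{-# OPTIONS --safe #-}
-- From an assignment σ, keep all of E₁ except the edges TRUE–u_j with σ_j false and
-- TRUE–ū_j with σ_j true.  Then u_j and ū_j are at distance 3 via a_j, ā_j, and a
-- true literal of C_i gives the path TRUE, literal, a/ā, C_i.  Conversely, in a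
-- realization, d(u_j, ū_j) = 3 forbids TRUE from being adjacent to both u_j and ū_j,
-- so "TRUE–u_j is an edge" is an assignment; every 3-edge path TRUE → C_i inside E₁
-- starts with an edge TRUE–u_k (resp. TRUE–ū_k) where u_k (resp. ū_k) occurs in
-- C_i, so that literal is true.
module Submission where

open import Defs
open import Data.Nat using (ℕ; _≤_; z≤n; s≤s)
open import Data.Fin using (Fin; _≟_)
open import Data.Bool using (Bool; true; false; _∨_; not)
import Data.Bool as Bool
open import Data.Bool.Properties using (∨-comm)
open import Data.Product using (_,_; proj₁; proj₂; Σ; _×_)
open import Data.Product.Properties using (≡-dec)
open import Data.Sum using (inj₁; inj₂)
open import Data.Empty using (⊥; ⊥-elim)
open import Data.List.Membership.Propositional using (_∈_; lose; find)
open import Function.Bundles using (_⇔_; mk⇔)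
open import Relation.Binary.Definitions using (DecidableEquality)
open import Relation.Binary.PropositionalEquality using (_≡_; _≢_; refl; trans; cong)
open import Relation.Nullary using (Dec; yes; no; does)
open import Relation.Nullary.Decidable using (dec-true)

does-true⇒ : ∀ {P : Set} (P? : Dec P) → does P? ≡ true → P
does-true⇒ (yes p) _ = p
does-true⇒ (no _) ()

∨-introˡ : ∀ {p} q → p ≡ true → p ∨ q ≡ true
∨-introˡ q refl = refl

true≢false : ∀ {b} → b ≡ true → b ≡ false → ⊥
true≢false refl ()

module _ {N M : ℕ} {E : EdgeSet N M} where

  walk₃ : ∀ {x y z w} → E x y ≡ true → E y z ≡ true → E z w ≡ true → Walk E x w 3
  walk₃ e₁ e₂ e₃ = cons e₁ (cons e₂ (cons e₃ nil))

  NoCommonNeighbour : X N M → X N M → Set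
  NoCommonNeighbour x y = ∀ z → E x z ≡ true → E z y ≡ true → ⊥

  3≤walk-length : ∀ {x y m} → x ≢ y → E x y ≡ false → NoCommonNeighbour x y →
                  Walk E x y m → 3 ≤ m
  3≤walk-length x≢y _ _ nil = ⊥-elim (x≢y refl)
  3≤walk-length _ ¬xy _ (cons xy nil) = ⊥-elim (true≢false xy ¬xy)
  3≤walk-length _ _ noMid (cons xz (cons zy nil)) = ⊥-elim (noMid _ xz zy)
  3≤walk-length _ _ _ (cons _ (cons _ (cons _ _))) = s≤s (s≤s (s≤s z≤n))

  distance-3 : ∀ {x y} → Walk E x y 3 → x ≢ y → E x y ≡ false → NoCommonNeighbour x y →
               DistEq E x y 3
  distance-3 w x≢y ¬xy noMid = w , λ _ → 3≤walk-length x≢y ¬xy noMid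

  distance-3⇒no-common-neighbour : ∀ {x y} → DistEq E x y 3 → NoCommonNeighbour x y
  distance-3⇒no-common-neighbour (_ , minimal) z xz zy
    with minimal 2 (cons xz (cons zy nil))
  ... | s≤s (s≤s ())

literalVertex : ∀ {N M} → Literal N → X N M
literalVertex (k , true)  = u k
literalVertex (k , false) = ubar k

literal-on-path-to-clause : ∀ {N M} {F : CNF N M} {i y z} →
  E1 F TRUE y → E1 F y z → E1 F z (C i) →
  Σ (Literal N) λ l → l ∈ F i × y ≡ literalVertex l
literal-on-path-to-clause (inj₁ (t-u k)) (inj₁ (u-a .k)) (inj₁ (a-C .k _ k∈)) = (k , true) , k∈ , refl
literal-on-path-to-clause (inj₁ (t-u k)) (inj₁ (u-a .k)) (inj₂ ())
literal-on-path-to-clause (inj₁ (t-u k)) (inj₂ (t-u .k)) (inj₁ ())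
literal-on-path-to-clause (inj₁ (t-u k)) (inj₂ (t-u .k)) (inj₂ ())
literal-on-path-to-clause (inj₁ (t-ubar k)) (inj₁ ())
literal-on-path-to-clause (inj₁ (t-ubar k)) (inj₂ (t-ubar .k)) (inj₁ ())
literal-on-path-to-clause (inj₁ (t-ubar k)) (inj₂ (t-ubar .k)) (inj₂ ())
literal-on-path-to-clause (inj₁ (t-ubar k)) (inj₂ (abar-ubar .k)) (inj₁ (abar-C .k _ k∈)) = (k , false) , k∈ , refl
literal-on-path-to-clause (inj₁ (t-ubar k)) (inj₂ (abar-ubar .k)) (inj₂ ())
literal-on-path-to-clause (inj₂ ())

module AssignmentGraph {N M : ℕ} (F : CNF N M) (σ : Assignment N) where
  open import Data.List.Membership.DecPropositional (≡-dec (_≟_ {N}) Bool._≟_) using (_∈?_)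

  selected : X N M → X N M → Bool
  selected TRUE     (u j)    = σ j
  selected TRUE     (ubar j) = not (σ j)
  selected (u j)    (a k)    = does (j ≟ k)
  selected (a j)    (abar k) = does (j ≟ k)
  selected (abar j) (ubar k) = does (j ≟ k)
  selected (a j)    (C i)    = does ((j , true) ∈? F i)
  selected (abar j) (C i)    = does ((j , false) ∈? F i)
  selected _        _        = false

  E : EdgeSet N M
  E x y = selected x y ∨ selected y x

  selected⊆E1dir : ∀ x y → selected x y ≡ true → E1dir F x y
  selected⊆E1dir TRUE (u j) _ = t-u j
  selected⊆E1dir TRUE (ubar j) _ = t-ubar j
  selected⊆E1dir (u j) (a k) e with does-true⇒ (j ≟ k) e
  ... | refl = u-a j
  selected⊆E1dir (a j) (abar k) e with does-true⇒ (j ≟ k) e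
  ... | refl = a-abar j
  selected⊆E1dir (abar j) (ubar k) e with does-true⇒ (j ≟ k) e
  ... | refl = abar-ubar j
  selected⊆E1dir (a j) (C i) e = a-C j i (does-true⇒ ((j , true) ∈? F i) e)
  selected⊆E1dir (abar j) (C i) e = abar-C j i (does-true⇒ ((j , false) ∈? F i) e)

  admissible : Admissible F E
  admissible = (λ x y → ∨-comm (selected x y) (selected y x)) , E⊆E1
    where
    E⊆E1 : ∀ x y → E x y ≡ true → E1 F x y
    E⊆E1 x y e with selected x y in xy
    ... | true  = inj₁ (selected⊆E1dir x y xy)
    ... | false = inj₂ (selected⊆E1dir y x e)

  ≟-refl : ∀ (j : Fin N) → does (j ≟ j) ≡ true
  ≟-refl j = dec-true (j ≟ j) refl

  true-literal-walk : ∀ {i} l → l ∈ F i → LitTrue σ l → Walk E TRUE (C i) 3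
  true-literal-walk {i} (k , true) k∈ σk =
    walk₃ {y = u k} {z = a k} (∨-introˡ false σk) (∨-introˡ false (≟-refl k))
      (∨-introˡ false (dec-true ((k , true) ∈? F i) k∈))
  true-literal-walk {i} (k , false) k∈ σk =
    walk₃ {y = ubar k} {z = abar k} (∨-introˡ false (cong not σk)) (≟-refl k)
      (∨-introˡ false (dec-true ((k , false) ∈? F i) k∈))

  u-ubar-no-common-neighbour : ∀ j → NoCommonNeighbour {E = E} (u j) (ubar j)
  u-ubar-no-common-neighbour j TRUE σj ¬σj = not-both (σ j) σj ¬σj
    where
    not-both : ∀ b → b ≡ true → not b ∨ false ≡ true → ⊥
    not-both true refl ()
  u-ubar-no-common-neighbour j (a _) _ ()
  u-ubar-no-common-neighbour j (u _) ()
  u-ubar-no-common-neighbour j (abar _) ()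
  u-ubar-no-common-neighbour j (ubar _) ()
  u-ubar-no-common-neighbour j (C _) ()

  TRUE-C-no-common-neighbour : ∀ i → NoCommonNeighbour {E = E} TRUE (C i)
  TRUE-C-no-common-neighbour i (u _) _ ()
  TRUE-C-no-common-neighbour i (ubar _) _ ()
  TRUE-C-no-common-neighbour i TRUE ()
  TRUE-C-no-common-neighbour i (a _) ()
  TRUE-C-no-common-neighbour i (abar _) ()
  TRUE-C-no-common-neighbour i (C _) ()

  realizes : Satisfies σ F → ∀ x y → InV x y → DistEq E x y d0V
  realizes _ _ _ (uv j) =
    distance-3 (walk₃ {y = a j} {z = abar j} (∨-introˡ false (≟-refl j))
                      (∨-introˡ false (≟-refl j)) (∨-introˡ false (≟-refl j)))
               (λ ()) refl (u-ubar-no-common-neighbour j)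
  realizes sat _ _ (tc i) with find (sat i)
  ... | l , l∈ , true-l =
    distance-3 (true-literal-walk l l∈ true-l) (λ ()) refl (TRUE-C-no-common-neighbour i)

module RealizationAssignment {N M : ℕ} (F : CNF N M) (E : EdgeSet N M)
  (admissible : Admissible F E) (realizes : ∀ x y → InV x y → DistEq E x y d0V) where

  σ : Assignment N
  σ j = E TRUE (u j)

  TRUE-literal-edge⇒true : ∀ l → E TRUE (literalVertex l) ≡ true → LitTrue σ l
  TRUE-literal-edge⇒true (k , true) e = e
  TRUE-literal-edge⇒true (k , false) e with E TRUE (u k) in σk
  ... | false = refl
  ... | true  = ⊥-elim (distance-3⇒no-common-neighbour (realizes _ _ (uv k)) TRUE
                          (trans (proj₁ admissible (u k) TRUE) σk) e)

  E⊆E1 : ∀ x y → E x y ≡ true → E1 F x y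
  E⊆E1 = proj₂ admissible

  satisfies : Satisfies σ F
  satisfies i with proj₁ (realizes _ _ (tc i))
  ... | cons e₁ (cons e₂ (cons e₃ nil))
      with literal-on-path-to-clause (E⊆E1 _ _ e₁) (E⊆E1 _ _ e₂) (E⊆E1 _ _ e₃)
  ... | l , l∈ , refl = lose l∈ (TRUE-literal-edge⇒true l e₁)

proposition5p3 : (N M : ℕ) (F : CNF N M) → Realizable F ⇔ Satisfiable F
proposition5p3 N M F = mk⇔
  (λ { (E , admissible , realizes) →
         RealizationAssignment.σ F E admissible realizes
       , RealizationAssignment.satisfies F E admissible realizes })
  (λ { (σ , sat) →
         AssignmentGraph.E F σ
       , AssignmentGraph.admissible F σ
       , AssignmentGraph.realizes F σ sat })
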